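{- Let $\mathcal{C} = \operatorname{Av}(312, 231)$, identified with the set of compositions as described in the context. For any positive integer $a$ and any compositions $A, B$, the classes $\operatorname{Av}_{\mathcal{C}}(aA)$ and $\operatorname{Av}_{\mathcal{C}}(aB)$ are Wilf-equivalent if and only if $\operatorname{Av}_{\mathcal{C}}(A)$ and $\operatorname{Av}_{\mathcal{C}}(B)$ are Wilf-equivalent.
   Context: For permutations $\pi,\sigma$, $\pi\preceq\sigma$ means $\sigma$ has a subsequence order-isomorphic to $\pi$; $\operatorname{Av}_{\mathcal{C}}(\pi)=\mathcal{C}\cap\operatorname{Av}(\pi)$, the permutations of $\mathcal{C}$ avoiding $\pi$. Two classes are Wilf-equivalent if they have the same number of permutations of each size. The permutations in $\operatorname{Av}(312,231)$ are exactly the layered permutations $\delta_1\oplus\cdots\oplus\delta_k$ with each $\delta_i$ decreasing; such a permutation is identified with the composition $|\delta_1|\cdots|\delta_k|$ (empty permutation = empty composition). Under this identification, $a_1\cdots a_k \preceq b_1\cdots b_m$ iff there are indices $i_1<\cdots<i_k$ with $a_j \le b_{i_j}$ for all $j$. Here $aA$ denotes the composition with first part $a$ followed by the parts of $A$. -}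

module Defs where

open import Data.Nat using (ℕ; zero; suc; _≤_; _≤?_)
open import Data.Nat.Properties using (_≟_)
open import Data.List using (List; []; _∷_; length; filter; map; concatMap; cartesianProductWith; upTo)
open import Data.Nat.ListAction using (sum)
open import Data.List.Relation.Unary.All using (All)
open import Relation.Binary.PropositionalEquality using (_≡_)
open import Relation.Nullary using (Dec; yes; no; ¬_)
open import Relation.Nullary.Decidable using (¬?)

-- It stands for the
-- layered permutation δ₁ ⊕ ⋯ ⊕ δₖ of Av(312,231) with |δᵢ| = i-th part;
-- its size (the size of the permutation) is the sum of the parts.
IsComposition : List ℕ → Set
IsComposition = All (1 ≤_)

-- Pattern containment on compositions:
-- a₁⋯aₖ ≼ b₁⋯bₘ iff there are i₁ < ⋯ < iₖ with aⱼ ≤ b_{iⱼ}.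
data _≼_ : List ℕ → List ℕ → Set where
  nil  : ∀ {ys} → [] ≼ ys
  keep : ∀ {x y xs ys} → x ≤ y → xs ≼ ys → (x ∷ xs) ≼ (y ∷ ys)
  skip : ∀ {xs y ys} → xs ≼ ys → xs ≼ (y ∷ ys)

_≼?_ : (xs ys : List ℕ) → Dec (xs ≼ ys)
[] ≼? ys = yes nil
(x ∷ xs) ≼? [] = no (λ ())
(x ∷ xs) ≼? (y ∷ ys) with x ≤? y | xs ≼? ys | (x ∷ xs) ≼? ys
... | yes p | yes q | _ = yes (keep p q)
... | _ | _ | yes r = yes (skip r)
... | no ¬p | _ | no ¬r = no λ { (keep p _) → ¬p p ; (skip r) → ¬r r }
... | yes _ | no ¬q | no ¬r = no λ { (keep _ q) → ¬q q ; (skip r) → ¬r r }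

listsOf : ℕ → ℕ → List (List ℕ)
listsOf m zero = [] ∷ []
listsOf m (suc k) = cartesianProductWith _∷_ (map suc (upTo m)) (listsOf m k)

compositions : ℕ → List (List ℕ)
compositions n = filter (λ σ → sum σ ≟ n) (concatMap (listsOf n) (upTo (suc n)))

avCount : List ℕ → ℕ → ℕ
avCount π n = length (filter (λ σ → ¬? (π ≼? σ)) (compositions n))

WilfEquiv : List ℕ → List ℕ → Set
WilfEquiv π τ = ∀ n → avCount π n ≡ avCount τ n

-- A composition avoiding aA either starts with a part b < a, after which the
-- rest must still avoid aA, or with a part b ≥ a, after which the rest must
-- avoid A.  So, with f n and g n the numbers of compositions of n avoiding aA
-- and A respectively, f 0 = 1 and
--   f (n + 1) = Σ_{b < a} f (n + 1 − b) + Σ_{a ≤ b ≤ n + 1} g (n + 1 − b).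
-- By strong induction f is determined by g.  Conversely, at n + 1 = a + q the
-- second sum is the prefix sum g q + ⋯ + g 0, so f determines these prefix
-- sums and hence g.
module Submission where

open import Defs
open import Data.List using (List; []; _∷_; _++_; map; filter; concatMap; length; cartesianProductWith; applyUpTo; upTo)
open import Data.Nat using (ℕ; zero; suc; _+_; _*_; _∸_; _≤_; _<_; z≤n; s≤s; _<?_)
open import Data.Nat.Induction using (<-rec)
open import Data.Nat.ListAction using (sum)
open import Data.Nat.Properties
open import Algebra.Properties.CommutativeSemigroup +-commutativeSemigroup using (interchange)
open import Function.Bundles using (_⇔_; mk⇔; Equivalence)
open import Level using (Level)
open import Relation.Binary.PropositionalEquality
open import Relation.Nullary using (Dec; yes; no; ¬_; ¬?)
open import Relation.Nullary.Negation using (contradiction; contraposition)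

private
  variable
    ℓ ℓ′ : Level
    X Y : Set ℓ
    P Q : Set ℓ

iverson : Dec P → ℕ
iverson (yes _) = 1
iverson (no _)  = 0

iverson-cong : P ⇔ Q → (p? : Dec P) (q? : Dec Q) → iverson p? ≡ iverson q?
iverson-cong _   (yes _) (yes _) = refl
iverson-cong P⇔Q (yes p) (no ¬q) = contradiction (Equivalence.to P⇔Q p) ¬q
iverson-cong P⇔Q (no ¬p) (yes q) = contradiction (Equivalence.from P⇔Q q) ¬p
iverson-cong _   (no _)  (no _)  = refl

iverson-no : ¬ P → (p? : Dec P) → iverson p? ≡ 0
iverson-no ¬p (yes p) = contradiction p ¬p
iverson-no ¬p (no _)  = refl

sumOver : List X → (X → ℕ) → ℕ
sumOver []       f = 0
sumOver (x ∷ xs) f = f x + sumOver xs f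

sumOver-++ : ∀ (xs ys : List X) f → sumOver (xs ++ ys) f ≡ sumOver xs f + sumOver ys f
sumOver-++ []       ys f = refl
sumOver-++ (x ∷ xs) ys f = trans (cong (f x +_) (sumOver-++ xs ys f)) (sym (+-assoc (f x) _ _))

sumOver-cong : ∀ (xs : List X) {f g : X → ℕ} → (∀ x → f x ≡ g x) → sumOver xs f ≡ sumOver xs g
sumOver-cong []       f≗g = refl
sumOver-cong (x ∷ xs) f≗g = cong₂ _+_ (f≗g x) (sumOver-cong xs f≗g)

sumOver-zero : ∀ (xs : List X) {f : X → ℕ} → (∀ x → f x ≡ 0) → sumOver xs f ≡ 0
sumOver-zero []       f≗0 = refl
sumOver-zero (x ∷ xs) f≗0 = cong₂ _+_ (f≗0 x) (sumOver-zero xs f≗0)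

sumOver-map : ∀ (g : X → Y) xs f → sumOver (map g xs) f ≡ sumOver xs (λ x → f (g x))
sumOver-map g []       f = refl
sumOver-map g (x ∷ xs) f = cong (f (g x) +_) (sumOver-map g xs f)

sumOver-concatMap : ∀ (g : X → List Y) xs f →
  sumOver (concatMap g xs) f ≡ sumOver xs (λ x → sumOver (g x) f)
sumOver-concatMap g []       f = refl
sumOver-concatMap g (x ∷ xs) f =
  trans (sumOver-++ (g x) (concatMap g xs) f) (cong (sumOver (g x) f +_) (sumOver-concatMap g xs f))

sumOver-cartesianProduct-∷ : ∀ (xs : List X) (yss : List (List X)) f →
  sumOver (cartesianProductWith _∷_ xs yss) f ≡ sumOver xs (λ x → sumOver yss (λ ys → f (x ∷ ys)))
sumOver-cartesianProduct-∷ []       yss f = refl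
sumOver-cartesianProduct-∷ (x ∷ xs) yss f =
  trans (sumOver-++ (map (x ∷_) yss) _ f)
        (cong₂ _+_ (sumOver-map (x ∷_) yss f) (sumOver-cartesianProduct-∷ xs yss f))

sumOver-filter : {P : X → Set ℓ′} (P? : ∀ x → Dec (P x)) (xs : List X) (f : X → ℕ) →
  sumOver (filter P? xs) f ≡ sumOver xs (λ x → iverson (P? x) * f x)
sumOver-filter P? []       f = refl
sumOver-filter P? (x ∷ xs) f with P? x
... | yes _ = cong₂ _+_ (sym (+-identityʳ (f x))) (sumOver-filter P? xs f)
... | no _  = sumOver-filter P? xs f

length-filter≡sumOver : {P : X → Set ℓ′} (P? : ∀ x → Dec (P x)) (xs : List X) →
  length (filter P? xs) ≡ sumOver xs (λ x → iverson (P? x))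
length-filter≡sumOver P? []       = refl
length-filter≡sumOver P? (x ∷ xs) with P? x
... | yes _ = cong suc (length-filter≡sumOver P? xs)
... | no _  = length-filter≡sumOver P? xs

sumBelow : ℕ → (ℕ → ℕ) → ℕ
sumBelow zero    f = 0
sumBelow (suc n) f = f 0 + sumBelow n (λ i → f (suc i))

sumOver-applyUpTo : ∀ (g : ℕ → X) n f → sumOver (applyUpTo g n) f ≡ sumBelow n (λ i → f (g i))
sumOver-applyUpTo g zero    f = refl
sumOver-applyUpTo g (suc n) f = cong (f (g 0) +_) (sumOver-applyUpTo (λ i → g (suc i)) n f)

sumBelow-cong< : ∀ n {f g} → (∀ i → i < n → f i ≡ g i) → sumBelow n f ≡ sumBelow n g
sumBelow-cong< zero    f≗g = refl
sumBelow-cong< (suc n) f≗g = cong₂ _+_ (f≗g 0 (s≤s z≤n)) (sumBelow-cong< n (λ i i<n → f≗g (suc i) (s≤s i<n)))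

sumBelow-cong : ∀ n {f g} → (∀ i → f i ≡ g i) → sumBelow n f ≡ sumBelow n g
sumBelow-cong n f≗g = sumBelow-cong< n (λ i _ → f≗g i)

sumBelow-zero : ∀ n {f} → (∀ i → f i ≡ 0) → sumBelow n f ≡ 0
sumBelow-zero zero    f≗0 = refl
sumBelow-zero (suc n) f≗0 = cong₂ _+_ (f≗0 0) (sumBelow-zero n (λ i → f≗0 (suc i)))

sumBelow-+ : ∀ n f g → sumBelow n (λ i → f i + g i) ≡ sumBelow n f + sumBelow n g
sumBelow-+ zero    f g = refl
sumBelow-+ (suc n) f g =
  trans (cong (f 0 + g 0 +_) (sumBelow-+ n _ _)) (interchange (f 0) (g 0) _ _)

sumBelow-swap : ∀ n m (f : ℕ → ℕ → ℕ) →
  sumBelow n (λ k → sumBelow m (f k)) ≡ sumBelow m (λ i → sumBelow n (λ k → f k i))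
sumBelow-swap zero    m f = sym (sumBelow-zero m (λ _ → refl))
sumBelow-swap (suc n) m f =
  trans (cong (sumBelow m (f 0) +_) (sumBelow-swap n m (λ k → f (suc k))))
        (sym (sumBelow-+ m (f 0) (λ i → sumBelow n (λ k → f (suc k) i))))

sumBelow-truncate : ∀ n m f → n ≤ m → (∀ i → n ≤ i → f i ≡ 0) → sumBelow m f ≡ sumBelow n f
sumBelow-truncate zero    m       f _         f≗0 = sumBelow-zero m (λ i → f≗0 i z≤n)
sumBelow-truncate (suc n) (suc m) f (s≤s n≤m) f≗0 =
  cong (f 0 +_) (sumBelow-truncate n m _ n≤m (λ i n≤i → f≗0 (suc i) (s≤s n≤i)))

sumBelow-+-split : ∀ m k f → sumBelow (m + k) f ≡ sumBelow m f + sumBelow k (λ j → f (m + j))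
sumBelow-+-split zero    k f = refl
sumBelow-+-split (suc m) k f =
  trans (cong (f 0 +_) (sumBelow-+-split m k (λ i → f (suc i)))) (sym (+-assoc (f 0) _ _))

sumOver-listsOf-suc : ∀ m k h →
  sumOver (listsOf m (suc k)) h ≡ sumBelow m (λ i → sumOver (listsOf m k) (λ σ → h (suc i ∷ σ)))
sumOver-listsOf-suc m k h =
  trans (sumOver-cartesianProduct-∷ (map suc (upTo m)) (listsOf m k) h)
        (trans (sumOver-map suc (upTo m) _) (sumOver-applyUpTo (λ i → i) m _))

sumBoundedLists : ℕ → ℕ → (List ℕ → ℕ) → ℕ
sumBoundedLists m K h = sumBelow K (λ k → sumOver (listsOf m k) h)

sumBoundedLists-cong : ∀ m K {h h′} → (∀ σ → h σ ≡ h′ σ) → sumBoundedLists m K h ≡ sumBoundedLists m K h′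
sumBoundedLists-cong m K h≗h′ = sumBelow-cong K (λ k → sumOver-cong (listsOf m k) h≗h′)

sumBoundedLists-zero : ∀ m K {h} → (∀ σ → h σ ≡ 0) → sumBoundedLists m K h ≡ 0
sumBoundedLists-zero m K h≗0 = sumBelow-zero K (λ k → sumOver-zero (listsOf m k) h≗0)

sumBoundedLists-suc : ∀ m K h →
  sumBoundedLists m (suc K) h ≡ h [] + sumBelow m (λ i → sumBoundedLists m K (λ σ → h (suc i ∷ σ)))
sumBoundedLists-suc m K h =
  cong₂ _+_ (+-identityʳ (h []))
        (trans (sumBelow-cong K (λ k → sumOver-listsOf-suc m k h))
               (sumBelow-swap K m (λ k i → sumOver (listsOf m k) (λ σ → h (suc i ∷ σ)))))

withSum : ℕ → (List ℕ → ℕ) → List ℕ → ℕ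
withSum n g σ = iverson (sum σ ≟ n) * g σ

withSum-∷-≤ : ∀ {n i} g σ → i ≤ n →
  withSum (suc n) g (suc i ∷ σ) ≡ withSum (n ∸ i) (λ τ → g (suc i ∷ τ)) σ
withSum-∷-≤ {n} {i} g σ i≤n = cong (_* g (suc i ∷ σ)) (iverson-cong (mk⇔ peel unpeel) (sum (suc i ∷ σ) ≟ suc n) (sum σ ≟ n ∸ i))
  where
  peel : suc i + sum σ ≡ suc n → sum σ ≡ n ∸ i
  peel eq = trans (sym (m+n∸m≡n i (sum σ))) (cong (_∸ i) (suc-injective eq))
  unpeel : sum σ ≡ n ∸ i → suc i + sum σ ≡ suc n
  unpeel eq = cong suc (trans (cong (i +_) eq) (m+[n∸m]≡n i≤n))

withSum-∷-> : ∀ {n i} g σ → n < i → withSum (suc n) g (suc i ∷ σ) ≡ 0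
withSum-∷-> {n} {i} g σ n<i = cong (_* g (suc i ∷ σ)) (iverson-no too-big (sum (suc i ∷ σ) ≟ suc n))
  where
  too-big : ¬ (suc i + sum σ ≡ suc n)
  too-big eq = <⇒≱ n<i (≤-trans (m≤m+n i (sum σ)) (≤-reflexive (suc-injective eq)))

sumBoundedLists-withSum-zero : ∀ m K g → sumBoundedLists m (suc K) (withSum 0 g) ≡ g []
sumBoundedLists-withSum-zero m K g = begin
  sumBoundedLists m (suc K) (withSum 0 g)
    ≡⟨ sumBoundedLists-suc m K (withSum 0 g) ⟩
  g [] + 0 + sumBelow m (λ i → sumBoundedLists m K (λ σ → withSum 0 g (suc i ∷ σ)))
    ≡⟨ cong (g [] + 0 +_) (sumBelow-zero m (λ i → sumBoundedLists-zero m K (λ σ → refl))) ⟩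
  g [] + 0 + 0
    ≡⟨ trans (+-identityʳ _) (+-identityʳ _) ⟩
  g [] ∎
  where open ≡-Reasoning

sumBoundedLists-withSum-suc : ∀ {m} K {n} g → suc n ≤ m →
  sumBoundedLists m (suc K) (withSum (suc n) g)
    ≡ sumBelow (suc n) (λ i → sumBoundedLists m K (withSum (n ∸ i) (λ σ → g (suc i ∷ σ))))
sumBoundedLists-withSum-suc {m} K {n} g n<m = begin
  sumBoundedLists m (suc K) (withSum (suc n) g)
    ≡⟨ sumBoundedLists-suc m K (withSum (suc n) g) ⟩
  sumBelow m (λ i → sumBoundedLists m K (λ σ → withSum (suc n) g (suc i ∷ σ)))
    ≡⟨ sumBelow-truncate (suc n) m _ n<m
         (λ i n<i → sumBoundedLists-zero m K (λ σ → withSum-∷-> g σ n<i)) ⟩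
  sumBelow (suc n) (λ i → sumBoundedLists m K (λ σ → withSum (suc n) g (suc i ∷ σ)))
    ≡⟨ sumBelow-cong< (suc n)
         (λ i i<sn → sumBoundedLists-cong m K (λ σ → withSum-∷-≤ g σ (≤-pred i<sn))) ⟩
  sumBelow (suc n) (λ i → sumBoundedLists m K (withSum (n ∸ i) (λ σ → g (suc i ∷ σ)))) ∎
  where open ≡-Reasoning

-- Compositions of n have at most n parts, each at most n, so bounds beyond
-- these only add lists whose sum is not n.
sumBoundedLists-withSum-stable : ∀ n {m K} g → n ≤ m → n < K →
  sumBoundedLists m K (withSum n g) ≡ sumBoundedLists n (suc n) (withSum n g)
sumBoundedLists-withSum-stable = <-rec Stable stable
  where
  Stable : ℕ → Set
  Stable n = ∀ {m K} g → n ≤ m → n < K →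
    sumBoundedLists m K (withSum n g) ≡ sumBoundedLists n (suc n) (withSum n g)

  stable : ∀ n → (∀ {n′} → n′ < n → Stable n′) → Stable n
  stable zero    _  {m} {suc K} g _ _ =
    trans (sumBoundedLists-withSum-zero m K g) (sym (sumBoundedLists-withSum-zero 0 0 g))
  stable (suc n) ih {m} {suc K} g n<m (s≤s n<K) = begin
    sumBoundedLists m (suc K) (withSum (suc n) g)
      ≡⟨ sumBoundedLists-withSum-suc K g n<m ⟩
    sumBelow (suc n) (λ i → sumBoundedLists m K (withSum (n ∸ i) (λ σ → g (suc i ∷ σ))))
      ≡⟨ sumBelow-cong (suc n) (λ i →
           trans (ih (n∸i<1+n i) (λ σ → g (suc i ∷ σ)) (≤-trans (m∸n≤m n i) (≤-trans (n≤1+n n) n<m)) (≤-<-trans (m∸n≤m n i) n<K))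
                 (sym (ih (n∸i<1+n i) (λ σ → g (suc i ∷ σ)) (≤-trans (m∸n≤m n i) (n≤1+n n)) (n∸i<1+n i)))) ⟩
    sumBelow (suc n) (λ i → sumBoundedLists (suc n) (suc n) (withSum (n ∸ i) (λ σ → g (suc i ∷ σ))))
      ≡⟨ sym (sumBoundedLists-withSum-suc (suc n) g ≤-refl) ⟩
    sumBoundedLists (suc n) (suc (suc n)) (withSum (suc n) g) ∎
    where
    open ≡-Reasoning
    n∸i<1+n : ∀ i → n ∸ i < suc n
    n∸i<1+n i = s≤s (m∸n≤m n i)

sumCompositions : ℕ → (List ℕ → ℕ) → ℕ
sumCompositions n g = sumOver (compositions n) g

sumCompositions≡sumBoundedLists : ∀ n g → sumCompositions n g ≡ sumBoundedLists n (suc n) (withSum n g)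
sumCompositions≡sumBoundedLists n g =
  trans (sumOver-filter (λ σ → sum σ ≟ n) (concatMap (listsOf n) (upTo (suc n))) g)
        (trans (sumOver-concatMap (listsOf n) (upTo (suc n)) _) (sumOver-applyUpTo (λ i → i) (suc n) _))

sumCompositions-cong : ∀ n {g g′} → (∀ σ → g σ ≡ g′ σ) → sumCompositions n g ≡ sumCompositions n g′
sumCompositions-cong n g≗g′ = sumOver-cong (compositions n) g≗g′

sumCompositions-suc : ∀ n g →
  sumCompositions (suc n) g ≡ sumBelow (suc n) (λ i → sumCompositions (n ∸ i) (λ σ → g (suc i ∷ σ)))
sumCompositions-suc n g = begin
  sumCompositions (suc n) g
    ≡⟨ sumCompositions≡sumBoundedLists (suc n) g ⟩
  sumBoundedLists (suc n) (suc (suc n)) (withSum (suc n) g)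
    ≡⟨ sumBoundedLists-withSum-suc (suc n) g ≤-refl ⟩
  sumBelow (suc n) (λ i → sumBoundedLists (suc n) (suc n) (withSum (n ∸ i) (λ σ → g (suc i ∷ σ))))
    ≡⟨ sumBelow-cong (suc n) (λ i →
         trans (sumBoundedLists-withSum-stable (n ∸ i) (λ σ → g (suc i ∷ σ)) (≤-trans (m∸n≤m n i) (n≤1+n n)) (s≤s (m∸n≤m n i)))
               (sym (sumCompositions≡sumBoundedLists (n ∸ i) _))) ⟩
  sumBelow (suc n) (λ i → sumCompositions (n ∸ i) (λ σ → g (suc i ∷ σ))) ∎
  where open ≡-Reasoning

avoids : List ℕ → List ℕ → ℕ
avoids π σ = iverson (¬? (π ≼? σ))

avoids-cong : ∀ {π σ π′ σ′} → π ≼ σ ⇔ π′ ≼ σ′ → avoids π σ ≡ avoids π′ σ′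
avoids-cong {π} {σ} {π′} {σ′} π≼σ⇔π′≼σ′ =
  iverson-cong (mk⇔ (contraposition (Equivalence.from π≼σ⇔π′≼σ′)) (contraposition (Equivalence.to π≼σ⇔π′≼σ′)))
               (¬? (π ≼? σ)) (¬? (π′ ≼? σ′))

avCount≡sumCompositions : ∀ π n → avCount π n ≡ sumCompositions n (avoids π)
avCount≡sumCompositions π n = length-filter≡sumOver (λ σ → ¬? (π ≼? σ)) (compositions n)

avCount-suc : ∀ π n →
  avCount π (suc n) ≡ sumBelow (suc n) (λ i → sumCompositions (n ∸ i) (λ τ → avoids π (suc i ∷ τ)))
avCount-suc π n = trans (avCount≡sumCompositions π (suc n)) (sumCompositions-suc n (avoids π))

≼-tail : ∀ {x xs ys} → (x ∷ xs) ≼ ys → xs ≼ ys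
≼-tail (keep _ xs≼ys) = skip xs≼ys
≼-tail (skip x∷xs≼ys) = skip (≼-tail x∷xs≼ys)

∷-≼-∷-< : ∀ {a b A τ} → b < a → (a ∷ A) ≼ (b ∷ τ) ⇔ (a ∷ A) ≼ τ
∷-≼-∷-< {a} {b} {A} {τ} b<a = mk⇔ drop skip
  where
  drop : (a ∷ A) ≼ (b ∷ τ) → (a ∷ A) ≼ τ
  drop (keep a≤b _) = contradiction a≤b (<⇒≱ b<a)
  drop (skip a∷A≼τ) = a∷A≼τ

∷-≼-∷-≥ : ∀ {a b A τ} → a ≤ b → (a ∷ A) ≼ (b ∷ τ) ⇔ A ≼ τ
∷-≼-∷-≥ {a} {b} {A} {τ} a≤b = mk⇔ drop (keep a≤b)
  where
  drop : (a ∷ A) ≼ (b ∷ τ) → A ≼ τ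
  drop (keep _ A≼τ) = A≼τ
  drop (skip a∷A≼τ) = ≼-tail a∷A≼τ

sumCompositions-avoids-< : ∀ {a b} A m → b < a →
  sumCompositions m (λ τ → avoids (a ∷ A) (b ∷ τ)) ≡ avCount (a ∷ A) m
sumCompositions-avoids-< {a} A m b<a =
  trans (sumCompositions-cong m (λ τ → avoids-cong (∷-≼-∷-< b<a))) (sym (avCount≡sumCompositions (a ∷ A) m))

sumCompositions-avoids-≥ : ∀ {a b} A m → a ≤ b →
  sumCompositions m (λ τ → avoids (a ∷ A) (b ∷ τ)) ≡ avCount A m
sumCompositions-avoids-≥ A m a≤b =
  trans (sumCompositions-cong m (λ τ → avoids-cong (∷-≼-∷-≥ a≤b))) (sym (avCount≡sumCompositions A m))

wilfEquiv-∷ : ∀ a {A B} → WilfEquiv A B → WilfEquiv (a ∷ A) (a ∷ B)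
wilfEquiv-∷ a {A} {B} A~B = <-rec (λ n → avCount (a ∷ A) n ≡ avCount (a ∷ B) n) step
  where
  step : ∀ n → (∀ {m} → m < n → avCount (a ∷ A) m ≡ avCount (a ∷ B) m) → avCount (a ∷ A) n ≡ avCount (a ∷ B) n
  step zero    _  = refl
  step (suc n) ih = begin
    avCount (a ∷ A) (suc n)   ≡⟨ avCount-suc (a ∷ A) n ⟩
    sumBelow (suc n) (term A) ≡⟨ sumBelow-cong (suc n) term-equal ⟩
    sumBelow (suc n) (term B) ≡⟨ sym (avCount-suc (a ∷ B) n) ⟩
    avCount (a ∷ B) (suc n)   ∎
    where
    open ≡-Reasoning
    term : List ℕ → ℕ → ℕ
    term C i = sumCompositions (n ∸ i) (λ τ → avoids (a ∷ C) (suc i ∷ τ))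
    term-equal : ∀ i → term A i ≡ term B i
    term-equal i with suc i <? a
    ... | yes i<a = trans (sumCompositions-avoids-< A (n ∸ i) i<a)
                      (trans (ih (s≤s (m∸n≤m n i))) (sym (sumCompositions-avoids-< B (n ∸ i) i<a)))
    ... | no i≮a  = trans (sumCompositions-avoids-≥ A (n ∸ i) (≮⇒≥ i≮a))
                      (trans (A~B (n ∸ i)) (sym (sumCompositions-avoids-≥ B (n ∸ i) (≮⇒≥ i≮a))))

prefixSum : (ℕ → ℕ) → ℕ → ℕ
prefixSum f q = sumBelow (suc q) (λ j → f (q ∸ j))

prefixSum-injective : ∀ {f g} → (∀ q → prefixSum f q ≡ prefixSum g q) → ∀ q → f q ≡ g q
prefixSum-injective     Σf≗Σg zero    = trans (sym (+-identityʳ _)) (trans (Σf≗Σg 0) (+-identityʳ _))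
prefixSum-injective {f} {g} Σf≗Σg (suc q) =
  +-cancelʳ-≡ (prefixSum f q) _ _ (trans (Σf≗Σg (suc q)) (cong (g (suc q) +_) (sym (Σf≗Σg q))))

avCount-∷-suc : ∀ a A q →
  avCount (suc a ∷ A) (suc (a + q)) ≡ sumBelow a (λ i → avCount (suc a ∷ A) (a + q ∸ i)) + prefixSum (avCount A) q
avCount-∷-suc a A q = begin
  avCount (suc a ∷ A) (suc (a + q))
    ≡⟨ avCount-suc (suc a ∷ A) (a + q) ⟩
  sumBelow (suc (a + q)) term
    ≡⟨ cong (λ k → sumBelow k term) (sym (+-suc a q)) ⟩
  sumBelow (a + suc q) term
    ≡⟨ sumBelow-+-split a (suc q) term ⟩
  sumBelow a term + sumBelow (suc q) (λ j → term (a + j))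
    ≡⟨ cong₂ _+_ (sumBelow-cong< a (λ i i<a → sumCompositions-avoids-< A (a + q ∸ i) (s≤s i<a)))
                 (sumBelow-cong (suc q) (λ j →
                    trans (sumCompositions-avoids-≥ A (a + q ∸ (a + j)) (s≤s (m≤m+n a j)))
                          (cong (avCount A) ([m+n]∸[m+o]≡n∸o a q j)))) ⟩
  sumBelow a (λ i → avCount (suc a ∷ A) (a + q ∸ i)) + prefixSum (avCount A) q ∎
  where
  open ≡-Reasoning
  term : ℕ → ℕ
  term i = sumCompositions (a + q ∸ i) (λ τ → avoids (suc a ∷ A) (suc i ∷ τ))

wilfEquiv-∷⁻ : ∀ a {A B} → WilfEquiv (suc a ∷ A) (suc a ∷ B) → WilfEquiv A B
wilfEquiv-∷⁻ a {A} {B} aA~aB = prefixSum-injective prefixSums-equal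
  where
  earlier : List ℕ → ℕ → ℕ
  earlier C q = sumBelow a (λ i → avCount (suc a ∷ C) (a + q ∸ i))
  prefixSums-equal : ∀ q → prefixSum (avCount A) q ≡ prefixSum (avCount B) q
  prefixSums-equal q = +-cancelˡ-≡ (earlier A q) _ _ (begin
    earlier A q + prefixSum (avCount A) q ≡⟨ sym (avCount-∷-suc a A q) ⟩
    avCount (suc a ∷ A) (suc (a + q))     ≡⟨ aA~aB (suc (a + q)) ⟩
    avCount (suc a ∷ B) (suc (a + q))     ≡⟨ avCount-∷-suc a B q ⟩
    earlier B q + prefixSum (avCount B) q ≡⟨ cong (_+ _) (sumBelow-cong a (λ i → sym (aA~aB (a + q ∸ i)))) ⟩
    earlier A q + prefixSum (avCount B) q ∎)
    where open ≡-Reasoning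

mainTheorem5 : (a : ℕ) (A B : List ℕ) → 1 ≤ a → IsComposition A → IsComposition B →
    (WilfEquiv (a ∷ A) (a ∷ B) ⇔ WilfEquiv A B)
mainTheorem5 (suc a) A B _ _ _ = mk⇔ (wilfEquiv-∷⁻ a) (wilfEquiv-∷ (suc a))
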